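{- Let $(G,L,f_0,f_t)$ be an instance of List Coloring Reconfiguration, let $T$ be a PMD-tree for $G$, let $y_1$ and $y_2$ be two children of a parallel node $x$ of $T$, and let $m$ be an integer with $m\ge\max\{|V(G_{y_1})|,|V(G_{y_2})|\}$. If $\mathrm{ID}_m(y_1)=\mathrm{ID}_m(y_2)$, then $G_{y_1}$ and $G_{y_2}$ are identical.
   Context: Graphs are finite and simple. For a color set $C$, graph $G=(V,E)$, list $L\colon V\to 2^C$, an $L$-coloring is a proper coloring $f$ with $f(v)\in L(v)$; $(G,L,f_0,f_t)$ consists of $G$, $L$ and two $L$-colorings. The vertex assignment of $v$ is $\mathrm{asg}(v)=(L(v),f_0(v),f_t(v))$. Substitution trees: for a graph $Q$ on nodes $u_1,\dots,u_p$ and disjoint graphs $G_1,\dots,G_p$, the $Q$-substitution is their disjoint union plus all edges between $V(G_i)$ and $V(G_j)$ whenever $u_iu_j\in E(Q)$. A substitution tree is a rooted tree where each non-leaf node $x$ has a quotient graph $Q_x$ and $|V(Q_x)|$ children; the corresponding graph $G_x$ of a leaf is one vertex, and of a non-leaf $x$ is the $Q_x$-substitution of the $G_y$ of its children $y$. A graph is prime if its only modules (sets $M$ with $N(v)\setminus M=N(w)\setminus M$ for all $v,w\in M$) are $\emptyset$, singletons and the whole vertex set. A PMD-tree for $G$ is a substitution tree whose root has corresponding graph $G$, whose internal nodes are 2-join ($Q_x\cong K_2$), parallel ($Q_x$ edgeless) or prime ($Q_x$ prime with $\ge 4$ vertices), with no two parallel nodes adjacent. Identical subgraphs: disjoint induced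 subgraphs $H_1,H_2$ of $G$ of equal size are identical if there is a bijection $\phi\colon V(H_1)\to V(H_2)$ that is an isomorphism $H_1\to H_2$ and satisfies, for all $v\in V(H_1)$, $N_G(v)\setminus V(H_1)=N_G(\phi(v))\setminus V(H_2)$ and $\mathrm{asg}(v)=\mathrm{asg}(\phi(v))$. ID-matrices: fix a total order $\prec$ on $V(G)$. For a node $y$ with $p=|V(G_y)|\le m$, list $V(G_y)$ as $v_1\prec\dots\prec v_p$. The $m$-ID-matrix $\mathrm{ID}_m(y)$ is the $(m+1)\times m$ matrix with entry $(i,j)$ equal to $1$ if $i,j\le p$ and $v_iv_j\in E(G_y)$; $0$ if $i,j\le p$ and $v_iv_j\notin E(G_y)$; $0$ if $i\le m$, $j\le m$ and ($i>p$ or $j>p$); $\mathrm{asg}(v_j)$ if $i=m+1$ and $j\le p$; and the symbol $\emptyset$ otherwise. -}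

module Defs where

open import Data.Nat using (ℕ; zero; suc; _<ᵇ_; _≤_)
open import Data.Bool using (Bool; true; false; _∧_; _∨_; not; if_then_else_)
open import Data.Fin using (Fin; zero; suc; toℕ; _≟_)
open import Data.Fin.Subset using (Subset; _∈_)
open import Data.Fin.Permutation using (Permutation′; _⟨$⟩ˡ_)
open import Data.List using (List; []; _∷_; length; map; filterᵇ; allFin)
open import Data.Maybe using (Maybe; just; nothing)
open import Data.Vec using (Vec; tabulate)
open import Data.Product using (Σ; _×_; _,_; proj₁; ∃)
open import Data.Sum using (_⊎_)
open import Data.Unit using (⊤)
open import Data.Empty using (⊥)
open import Function using (_∘_)
open import Function.Bundles using (_↔_; Inverse)
open import Relation.Nullary using (¬_)
open import Relation.Nullary.Decidable using (isYes)
open import Relation.Binary.PropositionalEquality using (_≡_; _≢_)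

record Graph (n : ℕ) : Set where
  field
    adj    : Fin n → Fin n → Bool
    sym    : ∀ u v → adj u v ≡ adj v u
    irrefl : ∀ v → adj v v ≡ false
open Graph public

IsLColoring : ∀ {n k} → Graph n → (Fin n → Subset k) → (Fin n → Fin k) → Set
IsLColoring G L f =
  (∀ v → f v ∈ L v) × (∀ u v → adj G u v ≡ true → f u ≢ f v)

record LCRInstance (n k : ℕ) : Set where
  field
    G     : Graph n
    L     : Fin n → Subset k
    f₀    : Fin n → Fin k
    fₜ    : Fin n → Fin k
    f₀-ok : IsLColoring G L f₀
    fₜ-ok : IsLColoring G L fₜ
open LCRInstance public

Assignment : ℕ → Set
Assignment k = Subset k × Fin k × Fin k

asg : ∀ {n k} → LCRInstance n k → Fin n → Assignment k
asg I v = (L I v , f₀ I v , fₜ I v)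

data STree (n : ℕ) : Set where
  leaf : Fin n → STree n
  node : (p : ℕ) → (Q : Fin p → Fin p → Bool) → (Fin p → STree n) → STree n

anyFin : ∀ p → (Fin p → Bool) → Bool
anyFin zero    f = false
anyFin (suc p) f = f zero ∨ anyFin p (f ∘ suc)

memb : ∀ {n} → STree n → Fin n → Bool
memb (leaf u)       v = isYes (u ≟ v)
memb (node p Q cs)  v = anyFin p (λ i → memb (cs i) v)

adjT : ∀ {n} → STree n → Fin n → Fin n → Bool
adjT (leaf _)      u v = false
adjT (node p Q cs) u v =
  anyFin p (λ i → adjT (cs i) u v)
  ∨ anyFin p (λ i → anyFin p (λ j → Q i j ∧ (memb (cs i) u ∧ memb (cs j) v)))

SimpleQ : ∀ p → (Fin p → Fin p → Bool) → Set
SimpleQ p Q = (∀ i j → Q i j ≡ Q j i) × (∀ i → Q i i ≡ false)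

WF : ∀ {n} → STree n → Set
WF (leaf v) = ⊤
WF (node p Q cs) =
  SimpleQ p Q
  × (∀ i j → i ≢ j → ∀ v → memb (cs i) v ≡ true → memb (cs j) v ≡ false)
  × (∀ i → WF (cs i))

IsModule : ∀ {p} → (Fin p → Fin p → Bool) → (Fin p → Bool) → Set
IsModule Q M = ∀ v w z → M v ≡ true → M w ≡ true → M z ≡ false → Q v z ≡ Q w z

IsPrimeGraph : ∀ p → (Fin p → Fin p → Bool) → Set
IsPrimeGraph p Q = ∀ M → IsModule Q M →
  (∀ z → M z ≡ false)
  ⊎ (Σ (Fin p) λ a → ∀ z → (M z ≡ true → z ≡ a) × (z ≡ a → M z ≡ true))
  ⊎ (∀ z → M z ≡ true)

IsParallelQ : ∀ {p} → (Fin p → Fin p → Bool) → Set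
IsParallelQ Q = ∀ i j → Q i j ≡ false

IsTwoJoinQ : ∀ p → (Fin p → Fin p → Bool) → Set
IsTwoJoinQ p Q = (p ≡ 2) × (∀ i j → i ≢ j → Q i j ≡ true)

IsPrimeQ : ∀ p → (Fin p → Fin p → Bool) → Set
IsPrimeQ p Q = (4 ≤ p) × IsPrimeGraph p Q

IsParallelNode : ∀ {n} → STree n → Set
IsParallelNode (leaf _)      = ⊥
IsParallelNode (node p Q cs) = IsParallelQ Q

PMDShape : ∀ {n} → STree n → Set
PMDShape (leaf _) = ⊤
PMDShape (node p Q cs) =
  (IsTwoJoinQ p Q ⊎ IsParallelQ Q ⊎ IsPrimeQ p Q)
  × (IsParallelQ Q → ∀ i → ¬ IsParallelNode (cs i))
  × (∀ i → PMDShape (cs i))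

IsPMDTree : ∀ {n} → Graph n → STree n → Set
IsPMDTree G T =
  WF T × PMDShape T
  × (∀ v → memb T v ≡ true)
  × (∀ u v → adjT T u v ≡ adj G u v)

data _⊑_ {n} : STree n → STree n → Set where
  here  : ∀ {x} → x ⊑ x
  there : ∀ {x p Q cs} (i : Fin p) → x ⊑ cs i → x ⊑ node p Q cs

-- ID-matrices. The total order ≺ on V(G) is given by a permutation π:
-- the i-th smallest vertex is π ⟨$⟩ˡ i.

size : ∀ {n} → STree n → ℕ
size {n} y = length (filterᵇ (memb y) (allFin n))

orderedV : ∀ {n} → Permutation′ n → STree n → List (Fin n)
orderedV {n} π y = filterᵇ (memb y) (map (π ⟨$⟩ˡ_) (allFin n))

nth : ∀ {A : Set} → List A → ℕ → Maybe A
nth []       _       = nothing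
nth (x ∷ xs) zero    = just x
nth (x ∷ xs) (suc i) = nth xs i

data Entry (k : ℕ) : Set where
  bit   : Bool → Entry k
  asgE  : Assignment k → Entry k
  empty : Entry k

-- 0-indexed (i, j); rows 0..m-1 are the adjacency part, row m the assignment row
IDentry : ∀ {n k} → LCRInstance n k → Permutation′ n → ℕ → STree n → ℕ → ℕ → Entry k
IDentry I π m y i j with nth (orderedV π y) i | nth (orderedV π y) j | i <ᵇ m
... | just a  | just b  | true  = bit (adjT y a b)
... | _       | _       | true  = bit false
... | _       | just b  | false = asgE (asg I b)
... | _       | nothing | false = empty

ID : ∀ {n k} → LCRInstance n k → Permutation′ n → (m : ℕ) → STree n → Vec (Vec (Entry k) m) (suc m)
ID I π m y = tabulate λ i → tabulate λ j → IDentry I π m y (toℕ i) (toℕ j)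

Sub : ∀ {n} → (Fin n → Bool) → Set
Sub {n} V = Σ (Fin n) λ v → V v ≡ true

countV : ∀ {n} → (Fin n → Bool) → ℕ
countV {n} V = length (filterᵇ V (allFin n))

Identical : ∀ {n k} → LCRInstance n k → (Fin n → Bool) → (Fin n → Bool) → Set
Identical I V₁ V₂ =
  (∀ v → V₁ v ≡ true → V₂ v ≡ false)
  × countV V₁ ≡ countV V₂
  × Σ (Sub V₁ ↔ Sub V₂) λ φ →
      let f = λ a → proj₁ (Inverse.to φ a) in
      (∀ a b → adj (G I) (f a) (f b) ≡ adj (G I) (proj₁ a) (proj₁ b))
      × (∀ a z → (adj (G I) (proj₁ a) z ∧ not (V₁ z)) ≡ (adj (G I) (f a) z ∧ not (V₂ z)))
      × (∀ a → asg I (proj₁ a) ≡ asg I (f a))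

-- Two children of a parallel node are modules of G with no edges between them, so they have the
-- same neighbourhood outside their union.  Reading each child's vertices in ≺-order enumerates it,
-- and equal ID-matrices say that these two enumerations have the same length, the same adjacency
-- bits and the same assignments position by position; matching equal positions is therefore an
-- isomorphism preserving assignments and outside neighbourhoods.
module Submission where

open import Defs hiding (sym)
open import Data.Nat as ℕ using (ℕ; _≤_; zero; suc; _<_; _<ᵇ_; _<?_; s≤s)
import Data.Nat.Properties as ℕ
open import Data.Fin using (Fin; toℕ; fromℕ<; cast; _≟_) renaming (zero to fzero; suc to fsuc)
open import Data.Fin.Properties using (suc-injective; toℕ<n; toℕ-fromℕ<; toℕ-cast; cast-involutive)
open import Data.Fin.Permutation using (Permutation′; _⟨$⟩ˡ_; _⟨$⟩ʳ_; inverseˡ; inverseʳ)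
open import Data.Bool using (Bool; true; false; _∧_; _∨_; not; T)
open import Data.Bool.Properties
  using (∨-identityʳ; ∧-zeroʳ; ∧-identityʳ; ∧-conicalˡ; ∧-conicalʳ; ¬-not; not-¬; T-≡)
open import Data.Empty using (⊥-elim)
open import Data.Product using (∃; _×_; _,_; proj₁; proj₂)
open import Data.Sum using (_⊎_; inj₁; inj₂)
open import Data.Maybe using (Maybe; just; nothing; is-just)
open import Data.List using (List; []; _∷_; length; lookup; map; filterᵇ; allFin)
open import Data.List.Membership.Propositional using (_∈_)
open import Data.List.Membership.Propositional.Properties
  using (∈-filter⁺; ∈-filter⁻; ∈-map⁺; ∈-allFin; ∈-lookup)
open import Data.List.Membership.Propositional.Properties.WithK using (unique⇒irrelevant; unique∧set⇒bag)
open import Data.List.Relation.Unary.Any using (index)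
open import Data.List.Relation.Unary.Any.Properties using (lookup-index)
open import Data.List.Relation.Unary.Unique.Propositional using (Unique)
import Data.List.Relation.Unary.Unique.Propositional.Properties as Unique
open import Data.List.Relation.Binary.BagAndSetEquality using (∼bag⇒↭)
open import Data.List.Relation.Binary.Permutation.Propositional.Properties using (↭-length)
open import Data.Vec using (tabulate) renaming (lookup to lookupᵥ)
open import Data.Vec.Properties using (lookup∘tabulate)
open import Function using (_∘_)
open import Function.Bundles using (_↔_; Inverse; Equivalence; mk↔ₛ′; mk⇔)
open import Function.Construct.Composition using (_↔-∘_)
open import Function.Construct.Symmetry using (↔-sym)
open import Relation.Nullary using (yes; no)
open import Relation.Nullary.Decidable using (T?)
open import Relation.Binary.PropositionalEquality
  using (_≡_; _≢_; refl; sym; trans; cong; cong₂; subst; subst₂; _≗_; ≢-sym; module ≡-Reasoning)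
open import Relation.Binary.PropositionalEquality.WithK using (≡-irrelevant)

-- Searching Fin p

∨-true⁻ : ∀ a b → a ∨ b ≡ true → a ≡ true ⊎ b ≡ true
∨-true⁻ true  _ _ = inj₁ refl
∨-true⁻ false _ e = inj₂ e

anyFin-true⁺ : ∀ p (f : Fin p → Bool) i → f i ≡ true → anyFin p f ≡ true
anyFin-true⁺ (suc p) f fzero    e rewrite e = refl
anyFin-true⁺ (suc p) f (fsuc i) e with f fzero
... | true  = refl
... | false = anyFin-true⁺ p _ i e

anyFin-true⁻ : ∀ p (f : Fin p → Bool) → anyFin p f ≡ true → ∃ λ i → f i ≡ true
anyFin-true⁻ (suc p) f e with ∨-true⁻ (f fzero) _ e
... | inj₁ e₀ = fzero , e₀
... | inj₂ e₁ with anyFin-true⁻ p _ e₁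
...   | i , eᵢ = fsuc i , eᵢ

anyFin-false⁺ : ∀ p (f : Fin p → Bool) → (∀ i → f i ≡ false) → anyFin p f ≡ false
anyFin-false⁺ zero    f _ = refl
anyFin-false⁺ (suc p) f h rewrite h fzero = anyFin-false⁺ p _ (λ i → h (fsuc i))

anyFin-only : ∀ p (f : Fin p → Bool) i → (∀ j → j ≢ i → f j ≡ false) → anyFin p f ≡ f i
anyFin-only (suc p) f fzero h =
  trans (cong (f fzero ∨_) (anyFin-false⁺ p _ λ j → h (fsuc j) λ ())) (∨-identityʳ (f fzero))
anyFin-only (suc p) f (fsuc i) h rewrite h fzero (λ ()) =
  anyFin-only p _ i λ j j≢i → h (fsuc j) λ e → j≢i (suc-injective e)

anyFin-cong : ∀ p {f g : Fin p → Bool} → f ≗ g → anyFin p f ≡ anyFin p g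
anyFin-cong zero    _ = refl
anyFin-cong (suc p) h = cong₂ _∨_ (h fzero) (anyFin-cong p (λ i → h (fsuc i)))

-- Substitution trees

adjT⇒memb : ∀ {n} (y : STree n) {u v} → adjT y u v ≡ true → memb y u ≡ true × memb y v ≡ true
adjT⇒memb (leaf _) ()
adjT⇒memb (node p Q cs) {u} {v} e with ∨-true⁻ _ _ e
... | inj₁ e₁ with anyFin-true⁻ p _ e₁
...   | i , eᵢ with adjT⇒memb (cs i) eᵢ
...     | mu , mv = anyFin-true⁺ p _ i mu , anyFin-true⁺ p _ i mv
adjT⇒memb (node p Q cs) {u} {v} e | inj₂ e₂ with anyFin-true⁻ p _ e₂
... | i , eᵢ with anyFin-true⁻ p _ eᵢ
...   | j , eᵢⱼ with ∧-conicalʳ (Q i j) _ eᵢⱼ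
...     | eₘ = anyFin-true⁺ p _ i (∧-conicalˡ _ (memb (cs j) v) eₘ)
             , anyFin-true⁺ p _ j (∧-conicalʳ (memb (cs i) u) _ eₘ)

adjT-outsideˡ : ∀ {n} (y : STree n) {u v} → memb y u ≡ false → adjT y u v ≡ false
adjT-outsideˡ y u∉y = ¬-not λ e → not-¬ (proj₁ (adjT⇒memb y e)) u∉y

adjT-outsideʳ : ∀ {n} (y : STree n) {u v} → memb y v ≡ false → adjT y u v ≡ false
adjT-outsideʳ y v∉y = ¬-not λ e → not-¬ (proj₂ (adjT⇒memb y e)) v∉y

⊑-trans : ∀ {n} {x y T : STree n} → x ⊑ y → y ⊑ T → x ⊑ T
⊑-trans x⊑y here        = x⊑y
⊑-trans x⊑y (there i s) = there i (⊑-trans x⊑y s)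

WF-⊑ : ∀ {n} {x T : STree n} → x ⊑ T → WF T → WF x
WF-⊑ here        wf           = wf
WF-⊑ (there i s) (_ , _ , wfs) = WF-⊑ s (wfs i)

memb-⊑ : ∀ {n} {x T : STree n} → x ⊑ T → ∀ {u} → memb x u ≡ true → memb T u ≡ true
memb-⊑ here                  u∈x = u∈x
memb-⊑ (there {p = p} i s) u∈x = anyFin-true⁺ p _ i (memb-⊑ s u∈x)

module _ {n p} {Q : Fin p → Fin p → Bool} {cs : Fin p → STree n} (wf : WF (node p Q cs)) where

  memb-sibling : ∀ {i j u} → memb (cs i) u ≡ true → j ≢ i → memb (cs j) u ≡ false
  memb-sibling {i} {j} {u} u∈i j≢i = proj₁ (proj₂ wf) i j (≢-sym j≢i) u u∈i

  child-unique : ∀ {i j u} → memb (cs i) u ≡ true → memb (cs j) u ≡ true → j ≡ i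
  child-unique {i} {j} u∈i u∈j with j ≟ i
  ... | yes j≡i = j≡i
  ... | no  j≢i = ⊥-elim (not-¬ u∈j (memb-sibling u∈i j≢i))

  adjT-node-child : ∀ i {u v} → memb (cs i) u ≡ true → memb (cs i) v ≡ true →
                    adjT (node p Q cs) u v ≡ adjT (cs i) u v
  adjT-node-child i {u} {v} u∈i v∈i =
    trans (cong₂ _∨_ (anyFin-only p _ i λ j j≢i → adjT-outsideˡ (cs j) (memb-sibling u∈i j≢i))
                     (anyFin-false⁺ p _ λ i′ → anyFin-false⁺ p _ (quotient-edge-false i′)))
          (∨-identityʳ _)
    where
    quotient-edge-false : ∀ i′ j′ → Q i′ j′ ∧ (memb (cs i′) u ∧ memb (cs j′) v) ≡ false
    quotient-edge-false i′ j′ with memb (cs i′) u in u∈i′ | memb (cs j′) v in v∈j′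
    ... | false | _     = ∧-zeroʳ (Q i′ j′)
    ... | true  | false = ∧-zeroʳ (Q i′ j′)
    ... | true  | true
      rewrite child-unique u∈i u∈i′ | child-unique v∈i v∈j′ =
        trans (∧-identityʳ (Q i i)) (proj₂ (proj₁ wf) i)

  adjT-parallel-children : IsParallelQ Q → ∀ {i j u v} → i ≢ j →
                           memb (cs i) u ≡ true → memb (cs j) v ≡ true →
                           adjT (node p Q cs) u v ≡ false
  adjT-parallel-children parallel {i} {j} {u} {v} i≢j u∈i v∈j =
    cong₂ _∨_ (anyFin-false⁺ p _ child-edge-false)
              (anyFin-false⁺ p _ λ i′ → anyFin-false⁺ p _ λ j′ → cong (_∧ _) (parallel i′ j′))
    where
    child-edge-false : ∀ c → adjT (cs c) u v ≡ false
    child-edge-false c with c ≟ i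
    ... | yes refl = adjT-outsideʳ (cs c) (memb-sibling v∈j i≢j)
    ... | no  c≢i  = adjT-outsideˡ (cs c) (memb-sibling u∈i c≢i)

adjT-⊑ : ∀ {n} {x T : STree n} → x ⊑ T → WF T → ∀ {u v} →
         memb x u ≡ true → memb x v ≡ true → adjT T u v ≡ adjT x u v
adjT-⊑ here        wf u∈x v∈x = refl
adjT-⊑ (there i s) wf u∈x v∈x =
  trans (adjT-node-child wf i (memb-⊑ s u∈x) (memb-⊑ s v∈x)) (adjT-⊑ s (proj₂ (proj₂ wf) i) u∈x v∈x)

memb-isModule : ∀ {n} {x T : STree n} → x ⊑ T → WF T → IsModule (adjT T) (memb x)
memb-isModule {x = x} here wf u w z u∈x w∈x z∉x =
  trans (adjT-outsideʳ x z∉x) (sym (adjT-outsideʳ x z∉x))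
memb-isModule (there {p = p} {Q = Q} {cs = cs} i s) wf u w z u∈x w∈x z∉x =
  cong₂ _∨_ (anyFin-cong p same-child-edges)
            (anyFin-cong p λ i′ → anyFin-cong p λ j′ →
               cong (λ b → Q i′ j′ ∧ (b ∧ memb (cs j′) z)) (same-child i′))
  where
  u∈i : memb (cs i) u ≡ true
  u∈i = memb-⊑ s u∈x
  w∈i : memb (cs i) w ≡ true
  w∈i = memb-⊑ s w∈x
  same-child : ∀ c → memb (cs c) u ≡ memb (cs c) w
  same-child c with c ≟ i
  ... | yes refl = trans u∈i (sym w∈i)
  ... | no  c≢i  = trans (memb-sibling wf u∈i c≢i) (sym (memb-sibling wf w∈i c≢i))
  same-child-edges : ∀ c → adjT (cs c) u z ≡ adjT (cs c) w z
  same-child-edges c with c ≟ i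
  ... | yes refl = memb-isModule s (proj₂ (proj₂ wf) i) u w z u∈x w∈x z∉x
  ... | no  c≢i  = trans (adjT-outsideˡ (cs c) (memb-sibling wf u∈i c≢i))
                         (sym (adjT-outsideˡ (cs c) (memb-sibling wf w∈i c≢i)))

module _ {n p} {Q : Fin p → Fin p → Bool} {cs : Fin p → STree n} {T : STree n}
         (x⊑T : node p Q cs ⊑ T) (wf : WF T) (parallel : IsParallelQ Q) where

  adjT-parallel-⊑ : ∀ {i j u v} → i ≢ j → memb (cs i) u ≡ true → memb (cs j) v ≡ true →
                    adjT T u v ≡ false
  adjT-parallel-⊑ {i} {j} i≢j u∈i v∈j =
    trans (adjT-⊑ x⊑T wf (anyFin-true⁺ p _ i u∈i) (anyFin-true⁺ p _ j v∈j))
          (adjT-parallel-children (WF-⊑ x⊑T wf) parallel i≢j u∈i v∈j)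

  parallel-siblings-outside : ∀ {i j u w z} → memb (cs i) u ≡ true → memb (cs j) w ≡ true →
                              memb (cs i) z ≡ false → memb (cs j) z ≡ false →
                              adjT T u z ≡ adjT T w z
  parallel-siblings-outside {i} {j} {u} {w} {z} u∈i w∈j z∉i z∉j
    with anyFin p (λ c → memb (cs c) z) in z∈node
  ... | false = memb-isModule x⊑T wf u w z (anyFin-true⁺ p _ i u∈i) (anyFin-true⁺ p _ j w∈j) z∈node
  ... | true with anyFin-true⁻ p _ z∈node
  ...   | c , z∈c = trans (adjT-parallel-⊑ (other-child z∉i) u∈i z∈c)
                          (sym (adjT-parallel-⊑ (other-child z∉j) w∈j z∈c))
    where
    other-child : ∀ {d} → memb (cs d) z ≡ false → d ≢ c
    other-child z∉d refl = not-¬ z∈c z∉d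

  siblings-outside-neighbourhood :
    ∀ {i j u w} → i ≢ j → memb (cs i) u ≡ true → memb (cs j) w ≡ true →
    ∀ z → (adjT T u z ∧ not (memb (cs i) z)) ≡ (adjT T w z ∧ not (memb (cs j) z))
  siblings-outside-neighbourhood {i} {j} i≢j u∈i w∈j z with memb (cs i) z in z∈i | memb (cs j) z in z∈j
  ... | true  | true  = ⊥-elim (not-¬ z∈j (memb-sibling (WF-⊑ x⊑T wf) z∈i (≢-sym i≢j)))
  ... | true  | false =
    trans (∧-zeroʳ _) (sym (trans (∧-identityʳ _) (adjT-parallel-⊑ (≢-sym i≢j) w∈j z∈i)))
  ... | false | true  = trans (∧-identityʳ _) (trans (adjT-parallel-⊑ i≢j u∈i z∈j) (sym (∧-zeroʳ _)))
  ... | false | false = cong (_∧ true) (parallel-siblings-outside u∈i w∈j z∈i z∈j)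

-- Enumerations of a vertex set

record Enumerates {n} (V : Fin n → Bool) (l : List (Fin n)) : Set where
  field
    unique   : Unique l
    sound    : ∀ {a} → a ∈ l → V a ≡ true
    complete : ∀ {a} → V a ≡ true → a ∈ l

filterᵇ-enumerates : ∀ {n} {xs : List (Fin n)} → (∀ a → a ∈ xs) → Unique xs →
                     ∀ V → Enumerates V (filterᵇ V xs)
filterᵇ-enumerates {xs = xs} every uxs V = record
  { unique   = Unique.filter⁺ (T? ∘ V) uxs
  ; sound    = λ a∈ → Equivalence.to T-≡ (proj₂ (∈-filter⁻ (T? ∘ V) {xs = xs} a∈))
  ; complete = λ {a} Va → ∈-filter⁺ (T? ∘ V) (every a) (Equivalence.from T-≡ Va)
  }

orderedV-enumerates : ∀ {n} (π : Permutation′ n) (y : STree n) → Enumerates (memb y) (orderedV π y)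
orderedV-enumerates {n} π y = filterᵇ-enumerates every (Unique.map⁺ (injective _ _) (Unique.allFin⁺ n)) (memb y)
  where
  every : ∀ a → a ∈ map (π ⟨$⟩ˡ_) (allFin n)
  every a = subst (_∈ _) (inverseˡ π) (∈-map⁺ (π ⟨$⟩ˡ_) (∈-allFin (π ⟨$⟩ʳ a)))
  injective : ∀ a b → π ⟨$⟩ˡ a ≡ π ⟨$⟩ˡ b → a ≡ b
  injective a b e = trans (sym (inverseʳ π)) (trans (cong (π ⟨$⟩ʳ_) e) (inverseʳ π))

enumerations-length : ∀ {n} {V : Fin n → Bool} {l l′} → Enumerates V l → Enumerates V l′ →
                      length l ≡ length l′
enumerations-length e e′ =
  ↭-length (∼bag⇒↭ (unique∧set⇒bag (unique e) (unique e′)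
    (mk⇔ (complete e′ ∘ sound e) (complete e ∘ sound e′))))
  where open Enumerates

size≡length-orderedV : ∀ {n} (π : Permutation′ n) (y : STree n) → size y ≡ length (orderedV π y)
size≡length-orderedV {n} π y =
  enumerations-length (filterᵇ-enumerates ∈-allFin (Unique.allFin⁺ n) (memb y)) (orderedV-enumerates π y)

index-∈-lookup : ∀ {A : Set} (xs : List A) i → index (∈-lookup {xs = xs} i) ≡ i
index-∈-lookup (x ∷ xs) fzero    = refl
index-∈-lookup (x ∷ xs) (fsuc i) = cong fsuc (index-∈-lookup xs i)

Sub-≡ : ∀ {n} {V : Fin n → Bool} {a a′} {h : V a ≡ true} {h′ : V a′ ≡ true} →
        a ≡ a′ → _≡_ {A = Sub V} (a , h) (a′ , h′)
Sub-≡ {h = h} {h′} refl = cong (_ ,_) (≡-irrelevant h h′)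

enumeration↔ : ∀ {n} {V : Fin n → Bool} {l} → Enumerates V l → Fin (length l) ↔ Sub V
enumeration↔ {l = l} e =
  mk↔ₛ′ (λ i → lookup l i , sound (∈-lookup i)) (λ (_ , Va) → index (complete Va))
  (λ (_ , Va) → Sub-≡ (sym (lookup-index (complete Va))))
  (λ i → trans (cong index (unique⇒irrelevant unique _ _)) (index-∈-lookup l i))
  where open Enumerates e

cast↔ : ∀ {m n} → m ≡ n → Fin m ↔ Fin n
cast↔ e = mk↔ₛ′ (cast e) (cast (sym e)) (cast-involutive e (sym e)) (cast-involutive (sym e) e)

-- Reading an ID-matrix

nth-lookup : ∀ {A : Set} (xs : List A) i → nth xs (toℕ i) ≡ just (lookup xs i)
nth-lookup (x ∷ xs) fzero    = refl
nth-lookup (x ∷ xs) (fsuc i) = nth-lookup xs i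

nth-≥length : ∀ {A : Set} (xs : List A) {k} → length xs ≤ k → nth xs k ≡ nothing
nth-≥length []       _         = refl
nth-≥length (x ∷ xs) (s≤s len≤k) = nth-≥length xs len≤k

nth-is-just⇒length-≡ : ∀ {A : Set} (xs ys : List A) → (∀ k → is-just (nth xs k) ≡ is-just (nth ys k)) →
                       length xs ≡ length ys
nth-is-just⇒length-≡ []       []       _ = refl
nth-is-just⇒length-≡ []       (y ∷ ys) h with () ← h 0
nth-is-just⇒length-≡ (x ∷ xs) []       h with () ← h 0
nth-is-just⇒length-≡ (x ∷ xs) (y ∷ ys) h = cong suc (nth-is-just⇒length-≡ xs ys (h ∘ suc))

asgEntry : ∀ {n k} → LCRInstance n k → Maybe (Fin n) → Entry k
asgEntry I (just b) = asgE (asg I b)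
asgEntry I nothing  = empty

bit-injective : ∀ {k} {a b : Bool} → bit {k} a ≡ bit b → a ≡ b
bit-injective refl = refl

asgE-injective : ∀ {k} {a b : Assignment k} → asgE a ≡ asgE b → a ≡ b
asgE-injective refl = refl

asgEntry-is-just : ∀ {n k} (I : LCRInstance n k) x y → asgEntry I x ≡ asgEntry I y → is-just x ≡ is-just y
asgEntry-is-just I (just a) (just b) _ = refl
asgEntry-is-just I nothing  nothing  _ = refl

module _ {n k} (I : LCRInstance n k) (π : Permutation′ n) (m : ℕ) (y : STree n) where

  IDentry-last-row : ∀ c → IDentry I π m y m c ≡ asgEntry I (nth (orderedV π y) c)
  IDentry-last-row c with nth (orderedV π y) m | nth (orderedV π y) c | m <ᵇ m in m<ᵇm
  ... | _       | _       | true  = ⊥-elim (ℕ.<-irrefl refl (ℕ.<ᵇ⇒< m m (Equivalence.from T-≡ m<ᵇm)))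
  ... | just _  | just _  | false = refl
  ... | nothing | just _  | false = refl
  ... | just _  | nothing | false = refl
  ... | nothing | nothing | false = refl

  IDentry-adjacency : ∀ {r c a b} → r < m →
                      nth (orderedV π y) r ≡ just a → nth (orderedV π y) c ≡ just b →
                      IDentry I π m y r c ≡ bit (adjT y a b)
  IDentry-adjacency r<m a-at-r b-at-c
    rewrite a-at-r | b-at-c | Equivalence.to T-≡ (ℕ.<⇒<ᵇ r<m) = refl

  lookup-ID : ∀ r c → lookupᵥ (lookupᵥ (ID I π m y) r) c ≡ IDentry I π m y (toℕ r) (toℕ c)
  lookup-ID r c = begin
    lookupᵥ (lookupᵥ (ID I π m y) r) c
      ≡⟨ cong (λ row → lookupᵥ row c) (lookup∘tabulate (λ i → tabulate λ j → entry (toℕ i) (toℕ j)) r) ⟩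
    lookupᵥ (tabulate (λ j → entry (toℕ r) (toℕ j))) c
      ≡⟨ lookup∘tabulate (λ j → entry (toℕ r) (toℕ j)) c ⟩
    entry (toℕ r) (toℕ c) ∎
    where
    open ≡-Reasoning
    entry = IDentry I π m y

module SameID {n k} (I : LCRInstance n k) (π : Permutation′ n) (m : ℕ) (y₁ y₂ : STree n)
              (y₁≤m : size y₁ ≤ m) (y₂≤m : size y₂ ≤ m) (same : ID I π m y₁ ≡ ID I π m y₂) where

  l₁ l₂ : List (Fin n)
  l₁ = orderedV π y₁
  l₂ = orderedV π y₂

  entry-≡ : ∀ {r c} → r ≤ m → c < m → IDentry I π m y₁ r c ≡ IDentry I π m y₂ r c
  entry-≡ {r} {c} r≤m c<m = begin
    IDentry I π m y₁ r c                   ≡⟨ at y₁ ⟨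
    lookupᵥ (lookupᵥ (ID I π m y₁) r′) c′  ≡⟨ cong (λ M → lookupᵥ (lookupᵥ M r′) c′) same ⟩
    lookupᵥ (lookupᵥ (ID I π m y₂) r′) c′  ≡⟨ at y₂ ⟩
    IDentry I π m y₂ r c                   ∎
    where
    open ≡-Reasoning
    r′ = fromℕ< (s≤s r≤m)
    c′ = fromℕ< c<m
    at : ∀ y → lookupᵥ (lookupᵥ (ID I π m y) r′) c′ ≡ IDentry I π m y r c
    at y = trans (lookup-ID I π m y r′ c′) (cong₂ (IDentry I π m y) (toℕ-fromℕ< _) (toℕ-fromℕ< c<m))

  length≤m : ∀ y → size y ≤ m → length (orderedV π y) ≤ m
  length≤m y y≤m = subst (_≤ m) (size≡length-orderedV π y) y≤m

  length-≡ : length l₁ ≡ length l₂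
  length-≡ = nth-is-just⇒length-≡ l₁ l₂ occupied-≡
    where
    occupied-≡ : ∀ c → is-just (nth l₁ c) ≡ is-just (nth l₂ c)
    occupied-≡ c with c <? m
    ... | yes c<m = asgEntry-is-just I _ _
          (trans (sym (IDentry-last-row I π m y₁ c))
                 (trans (entry-≡ ℕ.≤-refl c<m) (IDentry-last-row I π m y₂ c)))
    ... | no  c≮m =
          cong is-just (trans (nth-≥length l₁ (beyond y₁ y₁≤m)) (sym (nth-≥length l₂ (beyond y₂ y₂≤m))))
      where
      beyond : ∀ y → size y ≤ m → length (orderedV π y) ≤ c
      beyond y y≤m = ℕ.≤-trans (length≤m y y≤m) (ℕ.≮⇒≥ c≮m)

  transfer : Fin (length l₁) → Fin (length l₂)
  transfer = cast length-≡

  nth-transfer : ∀ r → nth l₂ (toℕ r) ≡ just (lookup l₂ (transfer r))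
  nth-transfer r =
    subst (λ t → nth l₂ t ≡ just (lookup l₂ (transfer r))) (toℕ-cast length-≡ r) (nth-lookup l₂ (transfer r))

  toℕ<m : ∀ (r : Fin (length l₁)) → toℕ r < m
  toℕ<m r = ℕ.≤-trans (toℕ<n r) (length≤m y₁ y₁≤m)

  asg-transfer : ∀ r → asg I (lookup l₁ r) ≡ asg I (lookup l₂ (transfer r))
  asg-transfer r = asgE-injective (begin
    asgE (asg I (lookup l₁ r))               ≡⟨ cong (asgEntry I) (nth-lookup l₁ r) ⟨
    asgEntry I (nth l₁ (toℕ r))               ≡⟨ IDentry-last-row I π m y₁ (toℕ r) ⟨
    IDentry I π m y₁ m (toℕ r)               ≡⟨ entry-≡ ℕ.≤-refl (toℕ<m r) ⟩
    IDentry I π m y₂ m (toℕ r)               ≡⟨ IDentry-last-row I π m y₂ (toℕ r) ⟩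
    asgEntry I (nth l₂ (toℕ r))               ≡⟨ cong (asgEntry I) (nth-transfer r) ⟩
    asgE (asg I (lookup l₂ (transfer r)))    ∎)
    where open ≡-Reasoning

  adjT-transfer : ∀ r c → adjT y₁ (lookup l₁ r) (lookup l₁ c)
                        ≡ adjT y₂ (lookup l₂ (transfer r)) (lookup l₂ (transfer c))
  adjT-transfer r c = bit-injective (begin
    bit (adjT y₁ (lookup l₁ r) (lookup l₁ c))
      ≡⟨ IDentry-adjacency I π m y₁ (toℕ<m r) (nth-lookup l₁ r) (nth-lookup l₁ c) ⟨
    IDentry I π m y₁ (toℕ r) (toℕ c)
      ≡⟨ entry-≡ (ℕ.<⇒≤ (toℕ<m r)) (toℕ<m c) ⟩
    IDentry I π m y₂ (toℕ r) (toℕ c)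
      ≡⟨ IDentry-adjacency I π m y₂ (toℕ<m r) (nth-transfer r) (nth-transfer c) ⟩
    bit (adjT y₂ (lookup l₂ (transfer r)) (lookup l₂ (transfer c))) ∎)
    where open ≡-Reasoning

  private
    enumerate₁ : Fin (length l₁) ↔ Sub (memb y₁)
    enumerate₁ = enumeration↔ (orderedV-enumerates π y₁)

    position : Sub (memb y₁) → Fin (length l₁)
    position = Inverse.from enumerate₁

    at-position : ∀ s → lookup l₁ (position s) ≡ proj₁ s
    at-position s = cong proj₁ (Inverse.strictlyInverseˡ enumerate₁ s)

  match : Sub (memb y₁) ↔ Sub (memb y₂)
  match = enumeration↔ (orderedV-enumerates π y₂) ↔-∘ (cast↔ length-≡ ↔-∘ ↔-sym enumerate₁)

  size-≡ : size y₁ ≡ size y₂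
  size-≡ = trans (size≡length-orderedV π y₁) (trans length-≡ (sym (size≡length-orderedV π y₂)))

  match-asg : ∀ s → asg I (proj₁ s) ≡ asg I (proj₁ (Inverse.to match s))
  match-asg s = trans (cong (asg I) (sym (at-position s))) (asg-transfer (position s))

  match-adjT : ∀ s t → adjT y₂ (proj₁ (Inverse.to match s)) (proj₁ (Inverse.to match t))
                     ≡ adjT y₁ (proj₁ s) (proj₁ t)
  match-adjT s t =
    trans (sym (adjT-transfer (position s) (position t))) (cong₂ (adjT y₁) (at-position s) (at-position t))

lemma2 : ∀ {n k} (I : LCRInstance n k) (T : STree n) → IsPMDTree (G I) T →
    (π : Permutation′ n) →
    ∀ {p Q cs} → node p Q cs ⊑ T → IsParallelQ Q →
    (i j : Fin p) → i ≢ j →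
    (m : ℕ) → size (cs i) ≤ m → size (cs j) ≤ m →
    ID I π m (cs i) ≡ ID I π m (cs j) →
    Identical I (memb (cs i)) (memb (cs j))
lemma2 I T (wf , _ , _ , T≡G) π {cs = cs} x⊑T parallel i j i≢j m i≤m j≤m same =
  disjoint , size-≡ , match , edges , outside , match-asg
  where
  open SameID I π m (cs i) (cs j) i≤m j≤m same
  f : Sub (memb (cs i)) → Fin _
  f s = proj₁ (Inverse.to match s)

  disjoint : ∀ v → memb (cs i) v ≡ true → memb (cs j) v ≡ false
  disjoint v v∈i = memb-sibling (WF-⊑ x⊑T wf) v∈i (≢-sym i≢j)

  adj-within : ∀ c {u v} → memb (cs c) u ≡ true → memb (cs c) v ≡ true → adj (G I) u v ≡ adjT (cs c) u v
  adj-within c u∈c v∈c = trans (sym (T≡G _ _)) (adjT-⊑ (⊑-trans (there c here) x⊑T) wf u∈c v∈c)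

  edges : ∀ s t → adj (G I) (f s) (f t) ≡ adj (G I) (proj₁ s) (proj₁ t)
  edges s@(a , a∈i) t@(b , b∈i) = begin
    adj (G I) (f s) (f t)    ≡⟨ adj-within j (proj₂ (Inverse.to match s)) (proj₂ (Inverse.to match t)) ⟩
    adjT (cs j) (f s) (f t)  ≡⟨ match-adjT s t ⟩
    adjT (cs i) a b          ≡⟨ adj-within i a∈i b∈i ⟨
    adj (G I) a b            ∎
    where open ≡-Reasoning

  outside : ∀ s z → (adj (G I) (proj₁ s) z ∧ not (memb (cs i) z))
                   ≡ (adj (G I) (f s) z ∧ not (memb (cs j) z))
  outside s z =
    subst₂ (λ b b′ → (b ∧ not (memb (cs i) z)) ≡ (b′ ∧ not (memb (cs j) z))) (T≡G _ z) (T≡G _ z)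
      (siblings-outside-neighbourhood x⊑T wf parallel i≢j (proj₂ s) (proj₂ (Inverse.to match s)) z)
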